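{- For every positive integer $k$, $$\sum_{n=0}^{k-1}(2n+k)\binom{ -k}{n}=\frac{(-1)^{k-1}k}{2}\binom{2k}{k}.$$
   Context: For an integer $m$ and nonnegative integer $n$, $\binom{m}{n}=\frac{m(m-1)\cdots(m-n+1)}{n!}$ (generalized binomial coefficient); in particular $\binom{ -k}{n}=(-1)^n\binom{n+k-1}{n}$. -}

module Defs where

open import Data.Nat as ℕ using (ℕ; zero; suc; _!)
open import Data.Nat.Properties using (_!≢0)
open import Data.Integer using (ℤ; +_; -_; _*_; _+_; _-_)
open import Data.Integer.DivMod using (_/ℕ_)

sign : ℕ → ℤ
sign zero    = + 1
sign (suc n) = - sign n

falling : ℤ → ℕ → ℤ
falling m zero    = + 1
falling m (suc n) = falling m n * (m - + n)

-- Generalized binomial coefficient binom(m, n) = m(m-1)...(m-n+1) / n!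
-- (the division is exact; /ℕ is integer division in Data.Integer.DivMod)
binom : ℤ → ℕ → ℤ
binom m n = (falling m n /ℕ (n !)) {{n !≢0}}

sumTo : ℕ → (ℕ → ℤ) → ℤ
sumTo zero    f = + 0
sumTo (suc m) f = sumTo m f + f m

{-# OPTIONS --safe #-}
module Submission where

-- With k = j + 1, both binomials are read off from falling factorials:
-- binom(-k, n) = (-1)^n C(j+n, n) and binom(2k, k) = 2 C(j+k, k).  The
-- absorption identity (n+1) C(j+n+1, n+1) = (k+n) C(j+n, n) makes the n-th
-- summand the difference G(n+1) - G(n) of the antidifference G(n) = (-1)^(n+1) n C(j+n, n), so
-- the sum telescopes to G(k) = (-1)^(k-1) k C(j+k, k).

open import Defs
open import Data.Nat as ℕ using (ℕ; zero; suc; _!; _≤_; _∸_; NonZero)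
import Data.Nat.Properties as ℕ
open import Data.Nat.Properties using (_!≢0)
open import Data.Nat.DivMod using (m/n*n≡m; m*n/n≡m; m*n%n≡0)
open import Data.Nat.Combinatorics using (_P_; _C_; nCk≡nPk/k!; nPk≡n!/[n∸k]!; nCk≡nC[n∸k])
open import Data.Nat.Combinatorics.Base using (_P′_)
open import Data.Nat.Combinatorics.Specification using (nP′k≡n!/[n∸k]!; nP′k≡n[n∸1P′k∸1]; k!∣nP′k)
open import Data.Integer using (ℤ; +_; -_; -[1+_]; _*_; _+_; _-_; _⊖_; _/ℕ_)
import Data.Integer.Properties as ℤ
open import Data.Integer.Tactic.RingSolver using (solve-∀)
open import Relation.Binary.PropositionalEquality

nCk*k!≡nP′k : ∀ {n k} → k ≤ n → (n C k) ℕ.* k ! ≡ n P′ k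
nCk*k!≡nP′k {n} {k} k≤n = begin
  (n C k) ℕ.* k !          ≡⟨ cong (ℕ._* k !) (nCk≡nPk/k! k≤n) ⟩
  ((n P k) / k !) ℕ.* k !  ≡⟨ cong (λ p → (p / k !) ℕ.* k !) nPk≡nP′k ⟩
  ((n P′ k) / k !) ℕ.* k ! ≡⟨ m/n*n≡m (k!∣nP′k k≤n) ⟩
  n P′ k                   ∎
  where
  open ≡-Reasoning
  open Data.Nat.DivMod using (_/_)
  instance _ = k !≢0
  nPk≡nP′k : n P k ≡ n P′ k
  nPk≡nP′k = trans (nPk≡n!/[n∸k]! k≤n) (sym (nP′k≡n!/[n∸k]! k≤n))

[1+k]*[1+n]C[1+k]≡[1+n]*nCk : ∀ {n k} → k ≤ n → suc k ℕ.* (suc n C suc k) ≡ suc n ℕ.* (n C k)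
[1+k]*[1+n]C[1+k]≡[1+n]*nCk {n} {k} k≤n = ℕ.*-cancelʳ-≡ _ _ (k !) {{k !≢0}} (begin
  suc k ℕ.* (suc n C suc k) ℕ.* k !   ≡⟨ cong (ℕ._* k !) (ℕ.*-comm (suc k) (suc n C suc k)) ⟩
  (suc n C suc k) ℕ.* suc k ℕ.* k !   ≡⟨ ℕ.*-assoc (suc n C suc k) (suc k) (k !) ⟩
  (suc n C suc k) ℕ.* suc k !         ≡⟨ nCk*k!≡nP′k (ℕ.s≤s k≤n) ⟩
  suc n P′ suc k                      ≡⟨ nP′k≡n[n∸1P′k∸1] (suc n) (suc k) ⟩
  suc n ℕ.* (n P′ k)                  ≡⟨ cong (suc n ℕ.*_) (nCk*k!≡nP′k k≤n) ⟨
  suc n ℕ.* ((n C k) ℕ.* k !)         ≡⟨ ℕ.*-assoc (suc n) (n C k) (k !) ⟨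
  suc n ℕ.* (n C k) ℕ.* k !           ∎)
  where open ≡-Reasoning

[2k]Ck≡2*[2k∸1]Ck : ∀ j → let k = suc j in (2 ℕ.* k) C k ≡ 2 ℕ.* ((j ℕ.+ k) C k)
[2k]Ck≡2*[2k∸1]Ck j = ℕ.*-cancelˡ-≡ _ _ k (begin
  k ℕ.* ((2 ℕ.* k) C k)                     ≡⟨ cong (λ n → k ℕ.* (n C k)) (cong (k ℕ.+_) (ℕ.+-identityʳ k)) ⟩
  k ℕ.* (suc (j ℕ.+ k) C k)                 ≡⟨ [1+k]*[1+n]C[1+k]≡[1+n]*nCk (ℕ.m≤m+n j k) ⟩
  (k ℕ.+ k) ℕ.* ((j ℕ.+ k) C j)             ≡⟨ cong ((k ℕ.+ k) ℕ.*_) (nCk≡nC[n∸k] (ℕ.m≤m+n j k)) ⟩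
  (k ℕ.+ k) ℕ.* ((j ℕ.+ k) C (j ℕ.+ k ∸ j)) ≡⟨ cong (λ i → (k ℕ.+ k) ℕ.* ((j ℕ.+ k) C i)) (ℕ.m+n∸m≡n j k) ⟩
  (k ℕ.+ k) ℕ.* ((j ℕ.+ k) C k)             ≡⟨ doubling k ((j ℕ.+ k) C k) ⟩
  k ℕ.* (2 ℕ.* ((j ℕ.+ k) C k))             ∎)
  where
  open ≡-Reasoning
  open import Data.Nat.Tactic.RingSolver using () renaming (solve-∀ to solve-ℕ)
  k : ℕ
  k = suc j
  doubling : ∀ a x → (a ℕ.+ a) ℕ.* x ≡ a ℕ.* (2 ℕ.* x)
  doubling = solve-ℕ

-[1+m]/ℕn≡-[[1+m]/n] : ∀ m n .{{_ : NonZero n}} → suc m ℕ.% n ≡ 0 → -[1+ m ] /ℕ n ≡ - + (suc m ℕ./ n)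
-[1+m]/ℕn≡-[[1+m]/n] m n [1+m]%n≡0 rewrite [1+m]%n≡0 = refl

[i*n]/ℕn≡i : ∀ i n .{{_ : NonZero n}} → (i * + n) /ℕ n ≡ i
[i*n]/ℕn≡i (+ a) n = trans (cong (_/ℕ n) (sym (ℤ.pos-* a n))) (cong +_ (m*n/n≡m a n))
[i*n]/ℕn≡i -[1+ a ] n@(suc _) = begin
  (-[1+ a ] * + n) /ℕ n      ≡⟨ cong (_/ℕ n) (ℤ.neg-distribˡ-* (+ suc a) (+ n)) ⟨
  (- (+ suc a * + n)) /ℕ n   ≡⟨ cong (λ x → (- x) /ℕ n) (ℤ.pos-* (suc a) n) ⟨
  (- + (suc a ℕ.* n)) /ℕ n   ≡⟨ -[1+m]/ℕn≡-[[1+m]/n] _ n (m*n%n≡0 (suc a) n) ⟩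
  - + (suc a ℕ.* n ℕ./ n)    ≡⟨ cong (λ x → - + x) (m*n/n≡m (suc a) n) ⟩
  -[1+ a ]                   ∎
  where open ≡-Reasoning

falling≡c*n!⇒binom≡c : ∀ m n {c} → falling m n ≡ c * + (n !) → binom m n ≡ c
falling≡c*n!⇒binom≡c m n {c} eq =
  trans (cong (λ x → (x /ℕ n !) {{n !≢0}}) eq) ([i*n]/ℕn≡i c (n !) {{n !≢0}})

falling+mn≡mP′n : ∀ {m n} → n ≤ m → falling (+ m) n ≡ + (m P′ n)
falling+mn≡mP′n {m} {zero}  _   = refl
falling+mn≡mP′n {m} {suc n} n<m = begin
  falling (+ m) n * (+ m - + n)  ≡⟨ cong₂ _*_ (falling+mn≡mP′n (ℕ.<⇒≤ n<m)) (ℤ.m-n≡m⊖n m n) ⟩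
  + (m P′ n) * (m ⊖ n)           ≡⟨ cong (+ (m P′ n) *_) (ℤ.⊖-≥ (ℕ.<⇒≤ n<m)) ⟩
  + (m P′ n) * + (m ∸ n)         ≡⟨ ℤ.pos-* (m P′ n) (m ∸ n) ⟨
  + ((m P′ n) ℕ.* (m ∸ n))       ≡⟨ cong +_ (ℕ.*-comm (m P′ n) (m ∸ n)) ⟩
  + (m P′ suc n)                 ∎
  where open ≡-Reasoning

falling-[1+j]n≡sign-n*[j+n]P′n : ∀ j n → falling (- + suc j) n ≡ sign n * + ((j ℕ.+ n) P′ n)
falling-[1+j]n≡sign-n*[j+n]P′n j zero    = refl
falling-[1+j]n≡sign-n*[j+n]P′n j (suc n) = begin
  falling (- + suc j) n * (- + suc j - + n)
    ≡⟨ cong₂ _*_ (falling-[1+j]n≡sign-n*[j+n]P′n j n) -[1+j]-n≡-[1+j+n] ⟩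
  sign n * + ((j ℕ.+ n) P′ n) * - + suc (j ℕ.+ n)
    ≡⟨ reorder (sign n) (+ ((j ℕ.+ n) P′ n)) (+ suc (j ℕ.+ n)) ⟩
  - sign n * (+ suc (j ℕ.+ n) * + ((j ℕ.+ n) P′ n))
    ≡⟨ cong (- sign n *_) (ℤ.pos-* (suc (j ℕ.+ n)) ((j ℕ.+ n) P′ n)) ⟨
  - sign n * + (suc (j ℕ.+ n) ℕ.* ((j ℕ.+ n) P′ n))
    ≡⟨ cong (λ x → - sign n * + x) (nP′k≡n[n∸1P′k∸1] (suc (j ℕ.+ n)) (suc n)) ⟨
  - sign n * + (suc (j ℕ.+ n) P′ suc n)
    ≡⟨ cong (λ i → - sign n * + (i P′ suc n)) (ℕ.+-suc j n) ⟨
  - sign n * + ((j ℕ.+ suc n) P′ suc n) ∎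
  where
  open ≡-Reasoning
  -[1+j]-n≡-[1+j+n] : - + suc j - + n ≡ - + suc (j ℕ.+ n)
  -[1+j]-n≡-[1+j+n] = sym (trans (cong -_ (ℤ.pos-+ (suc j) n)) (ℤ.neg-distrib-+ (+ suc j) (+ n)))
  reorder : ∀ s p q → s * p * - q ≡ - s * (q * p)
  reorder = solve-∀

binom+mn≡mCn : ∀ {m n} → n ≤ m → binom (+ m) n ≡ + (m C n)
binom+mn≡mCn {m} {n} n≤m = falling≡c*n!⇒binom≡c (+ m) n (begin
  falling (+ m) n          ≡⟨ falling+mn≡mP′n n≤m ⟩
  + (m P′ n)               ≡⟨ cong +_ (nCk*k!≡nP′k n≤m) ⟨
  + ((m C n) ℕ.* n !)      ≡⟨ ℤ.pos-* (m C n) (n !) ⟩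
  + (m C n) * + (n !)      ∎)
  where open ≡-Reasoning

binom-[1+j]n≡sign-n*[j+n]Cn : ∀ j n → binom (- + suc j) n ≡ sign n * + ((j ℕ.+ n) C n)
binom-[1+j]n≡sign-n*[j+n]Cn j n = falling≡c*n!⇒binom≡c (- + suc j) n (begin
  falling (- + suc j) n                  ≡⟨ falling-[1+j]n≡sign-n*[j+n]P′n j n ⟩
  sign n * + ((j ℕ.+ n) P′ n)            ≡⟨ cong (λ x → sign n * + x) (nCk*k!≡nP′k (ℕ.m≤n+m n j)) ⟨
  sign n * + (((j ℕ.+ n) C n) ℕ.* n !)   ≡⟨ cong (sign n *_) (ℤ.pos-* ((j ℕ.+ n) C n) (n !)) ⟩
  sign n * (+ ((j ℕ.+ n) C n) * + (n !)) ≡⟨ ℤ.*-assoc (sign n) (+ ((j ℕ.+ n) C n)) (+ (n !)) ⟨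
  sign n * + ((j ℕ.+ n) C n) * + (n !)   ∎)
  where open ≡-Reasoning

sumTo-cong : ∀ m {f g : ℕ → ℤ} → (∀ n → f n ≡ g n) → sumTo m f ≡ sumTo m g
sumTo-cong zero    f≗g = refl
sumTo-cong (suc m) f≗g = cong₂ _+_ (sumTo-cong m f≗g) (f≗g m)

sumTo-telescope : ∀ (g : ℕ → ℤ) m → sumTo m (λ n → g (suc n) - g n) ≡ g m - g 0
sumTo-telescope g zero    = sym (ℤ.+-inverseʳ (g 0))
sumTo-telescope g (suc m) = begin
  sumTo m (λ n → g (suc n) - g n) + (g (suc m) - g m) ≡⟨ cong (_+ (g (suc m) - g m)) (sumTo-telescope g m) ⟩
  g m - g 0 + (g (suc m) - g m)                       ≡⟨ cancel (g 0) (g m) (g (suc m)) ⟩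
  g (suc m) - g 0                                     ∎
  where
  open ≡-Reasoning
  cancel : ∀ a b c → b - a + (c - b) ≡ c - a
  cancel = solve-∀

antidifference : ℕ → ℕ → ℤ
antidifference j n = - sign n * + (n ℕ.* ((j ℕ.+ n) C n))

summand≡Δantidifference : ∀ j n →
  + (2 ℕ.* n ℕ.+ suc j) * binom (- + suc j) n ≡ antidifference j (suc n) - antidifference j n
summand≡Δantidifference j n = begin
  + (2 ℕ.* n ℕ.+ suc j) * binom (- + suc j) n
    ≡⟨ cong₂ _*_ +[2n+k]≡+2*+n++k (binom-[1+j]n≡sign-n*[j+n]Cn j n) ⟩
  (+ 2 * + n + + suc j) * (sign n * + Q n)
    ≡⟨ split (sign n) (+ n) (+ suc j) (+ Q n) ⟩
  - - sign n * ((+ suc j + + n) * + Q n) - - sign n * (+ n * + Q n)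
    ≡⟨ cong₂ (λ a b → - - sign n * a - - sign n * b) absorption (ℤ.pos-* n (Q n)) ⟨
  - - sign n * + (suc n ℕ.* Q (suc n)) - - sign n * + (n ℕ.* Q n) ∎
  where
  open ≡-Reasoning
  Q : ℕ → ℕ
  Q n = (j ℕ.+ n) C n
  +[2n+k]≡+2*+n++k : + (2 ℕ.* n ℕ.+ suc j) ≡ + 2 * + n + + suc j
  +[2n+k]≡+2*+n++k = trans (ℤ.pos-+ (2 ℕ.* n) (suc j)) (cong (_+ + suc j) (ℤ.pos-* 2 n))
  split : ∀ s m k q → (+ 2 * m + k) * (s * q) ≡ - - s * ((k + m) * q) - - s * (m * q)
  split = solve-∀
  absorption : + (suc n ℕ.* Q (suc n)) ≡ (+ suc j + + n) * + Q n
  absorption = begin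
    + (suc n ℕ.* Q (suc n))               ≡⟨ cong (λ i → + (suc n ℕ.* (i C suc n))) (ℕ.+-suc j n) ⟩
    + (suc n ℕ.* (suc (j ℕ.+ n) C suc n)) ≡⟨ cong +_ ([1+k]*[1+n]C[1+k]≡[1+n]*nCk (ℕ.m≤n+m n j)) ⟩
    + ((suc j ℕ.+ n) ℕ.* Q n)             ≡⟨ ℤ.pos-* (suc j ℕ.+ n) (Q n) ⟩
    + (suc j ℕ.+ n) * + Q n               ≡⟨ cong (_* + Q n) (ℤ.pos-+ (suc j) n) ⟩
    (+ suc j + + n) * + Q n               ∎

lemma2p4 : (j : ℕ) → let k = suc j in + 2 * sumTo k (λ n → + (2 ℕ.* n ℕ.+ k) * binom (- + k) n) ≡ sign j * + k * binom (+ (2 ℕ.* k)) k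
lemma2p4 j = begin
  + 2 * sumTo k (λ n → + (2 ℕ.* n ℕ.+ k) * binom (- + k) n)
    ≡⟨ cong (+ 2 *_) (sumTo-cong k (summand≡Δantidifference j)) ⟩
  + 2 * sumTo k (λ n → antidifference j (suc n) - antidifference j n)
    ≡⟨ cong (+ 2 *_) (sumTo-telescope (antidifference j) k) ⟩
  + 2 * (- - sign j * + (k ℕ.* Q) - + 0)
    ≡⟨ cong (λ x → + 2 * (- - sign j * x - + 0)) (ℤ.pos-* k Q) ⟩
  + 2 * (- - sign j * (+ k * + Q) - + 0)
    ≡⟨ rearrange (sign j) (+ k) (+ Q) ⟩
  sign j * + k * (+ 2 * + Q)
    ≡⟨ cong (sign j * + k *_) (ℤ.pos-* 2 Q) ⟨
  sign j * + k * + (2 ℕ.* Q)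
    ≡⟨ cong (λ x → sign j * + k * + x) ([2k]Ck≡2*[2k∸1]Ck j) ⟨
  sign j * + k * + ((2 ℕ.* k) C k)
    ≡⟨ cong (sign j * + k *_) (binom+mn≡mCn (ℕ.m≤m+n k (k ℕ.+ 0))) ⟨
  sign j * + k * binom (+ (2 ℕ.* k)) k ∎
  where
  open ≡-Reasoning
  k : ℕ
  k = suc j
  Q : ℕ
  Q = (j ℕ.+ k) C k
  rearrange : ∀ s m q → + 2 * (- - s * (m * q) - + 0) ≡ s * m * (+ 2 * q)
  rearrange = solve-∀
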